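{- Let $q$ be a prime power, $r^*=q^3-q$, $u^*=q^3+q^2$, $g^{(3)}=q^3-2q+1$, and let $\Omega_{r,s_1,\dots,s_{q-1},t_1,\dots,t_{q-1},u}$ be as in the context. Then \[\#\Omega_{r^*,0,\dots,0,0,\dots,0,u^*}=1-g^{(3)}+r^*+u^*,\] where all $s_\mu$ and $t_\nu$ equal $0$.
   Context: $q$ is a power of a prime. For integers $r,s_1,\dots,s_{q-1},t_1,\dots,t_{q-1},u$, $\Omega_{r,s_1,\dots,s_{q-1},t_1,\dots,t_{q-1},u}$ is the set of $(i,j_1,\dots,j_{q-1},k_1,\dots,k_{q-1})\in\mathbb{Z}^{2q-1}$ with $-r\le i$; $-s_\mu\le i+(q^2+q)k_\mu<-s_\mu+(q^2+q)$ for $1\le\mu\le q-1$; $-t_\nu\le qi+(q^2+q)j_\nu-(q+1)\sum_{\mu=1}^{q-1}k_\mu<-t_\nu+(q^2+q)$ for $1\le\nu\le q-1$; $-u\le -q^2i-(q^2+q)\sum_{\nu}j_\nu-(q+1)\sum_\mu k_\mu$. -}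

module Defs where

open import Data.Nat as ℕ using (ℕ; _∸_)
open import Data.Nat.Primality using (Prime)
open import Data.Integer as ℤ using (ℤ; +_; _+_; _-_; _*_; -_; _≤_; _<_)
open import Data.Vec using (Vec; foldr; map; replicate; []; _∷_)
open import Data.Unit using (⊤)
open import Relation.Binary.PropositionalEquality using (_≡_)
open import Data.Product using (Σ; _×_; _,_; ∃)
open import Data.List using (List; length)
open import Data.List.Membership.Propositional using (_∈_)
open import Data.List.Relation.Unary.Unique.Propositional using (Unique)
open import Function.Bundles using (_⇔_)

IsPrimePower : ℕ → Set
IsPrimePower q = Σ ℕ λ p → Σ ℕ λ k → Prime p × (1 ℕ.≤ k) × (q ≡ p ℕ.^ k)

sumℤ : ∀ {n} → Vec ℤ n → ℤ
sumℤ = foldr _ _+_ (+ 0)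

-- points (i, (j_1..j_{q-1}), (k_1..k_{q-1})) of ℤ^{2q-1}
Point : ℕ → Set
Point q = ℤ × Vec ℤ (q ∸ 1) × Vec ℤ (q ∸ 1)

AllPair : ∀ {n} → (ℤ → ℤ → Set) → Vec ℤ n → Vec ℤ n → Set
AllPair P [] [] = ⊤
AllPair P (a ∷ as) (b ∷ bs) = P a b × AllPair P as bs

InΩ : (q : ℕ) → ℤ → Vec ℤ (q ∸ 1) → Vec ℤ (q ∸ 1) → ℤ → Point q → Set
InΩ q r s t u (i , j , k) =
  (- r ≤ i)
  × AllPair (λ sμ kμ → (- sμ ≤ i + Q * kμ) × (i + Q * kμ < - sμ + Q)) s k
  × AllPair (λ tν jν → (- tν ≤ Qi + Q * jν - Q1 * sumℤ k)
                       × (Qi + Q * jν - Q1 * sumℤ k < - tν + Q)) t j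
  × (- u ≤ - ((+ q) * (+ q)) * i - Q * sumℤ j - Q1 * sumℤ k)
  where
    Q : ℤ
    Q = (+ q) * (+ q) + (+ q)
    Q1 : ℤ
    Q1 = + q + + 1
    Qi : ℤ
    Qi = (+ q) * i

HasCard : {A : Set} → (A → Set) → ℕ → Set
HasCard {A} P N = Σ (List A) λ L → Unique L × (∀ x → (x ∈ L) ⇔ P x) × (length L ≡ N)

module Submission where

-- With Q = q² + q, the k-window condition 0 ≤ i + Qk_μ < Q forces all k_μ to be
-- equal to one k, and then the j-window condition forces all j_ν to be equal to
-- one j.  Writing the residue i + Qk ∈ [0, Q) in base q + 1 as (q+1)c + e and
-- setting σ = j + c - (q+1)k, a point of Ω is thus the same as a quadruple of
-- `Param`eters (c, e, k, σ) subject to six inequalities (`Admissible`).  These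
-- force σ ∈ {-1, 0, 1}, and sorting by σ and by e = 0 / e > 0 shows that the
-- admissible parameters form four explicit families of k-windows (`Family`),
-- of sizes q, q², Σ_c (q - c)q and Σ_c Σ_{e<q} e, in total q + q² + q³.

open import Defs
open import Data.Nat as ℕ using (ℕ; zero; suc; _∸_; z≤n; s≤s)
import Data.Nat.Properties as ℕP
import Data.Nat.Tactic.RingSolver as ℕSolver
open import Algebra.Properties.CommutativeSemigroup ℕP.+-commutativeSemigroup
  using () renaming (interchange to +-interchange)
open import Data.Nat.Primality using (prime⇒nonTrivial)
open import Data.Nat.DivMod
  using (_/_; _%_; m≡m%n+[m/n]*n; m%n<n; m<n*o⇒m/o<n; [m+kn]%n≡m%n; m≤n⇒m%n≡m)
open import Data.Integer as ℤ using (ℤ; +_; -[1+_]; _+_; _-_; _*_; -_; _≤_; _<_; +≤+; +<+; -<-)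
import Data.Integer.Properties as ℤP
open import Data.Integer.Tactic.RingSolver using (solve-∀)
open import Data.List using (List; []; _∷_; _++_; map; length; upTo)
open import Data.List.Properties using (length-++; length-map; length-upTo)
open import Data.List.Membership.Propositional using (_∈_)
open import Data.List.Membership.Propositional.Properties
  using (∈-map⁺; ∈-map⁻; ∈-++⁺ˡ; ∈-++⁺ʳ; ∈-++⁻; ∈-upTo⁺; ∈-upTo⁻)
open import Data.List.Relation.Unary.All as All using ()
open import Data.List.Relation.Unary.Any using (here; there)
open import Data.List.Relation.Unary.AllPairs using ([]; _∷_)
open import Data.List.Relation.Unary.Unique.Propositional using (Unique)
import Data.List.Relation.Unary.Unique.Propositional.Properties as Unique
open import Data.Vec as Vec using (Vec; replicate; []; _∷_)
open import Data.Product using (Σ; _×_; _,_; proj₁; proj₂)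
open import Data.Sum using (inj₁; inj₂)
open import Data.Unit using (tt)
open import Data.Empty using (⊥; ⊥-elim)
open import Function.Bundles using (mk⇔)
open import Relation.Binary.PropositionalEquality
  using (_≡_; _≢_; refl; sym; trans; cong; cong₂; subst; subst₂; module ≡-Reasoning)
open import Relation.Binary.Definitions using (tri<; tri≈; tri>)
open import Relation.Nullary using (¬_; yes; no)

-- Every inequality below is proved by a
-- certificate: a ring identity (checked by the solver) writing the gap between
-- the two sides as a sum of products of manifestly non-negative terms.
NonNeg : ℤ → Set
NonNeg a = + 0 ≤ a

nonneg-ℕ : ∀ n → NonNeg (+ n)
nonneg-ℕ n = +≤+ z≤n

nonneg-+ : ∀ {a b} → NonNeg a → NonNeg b → NonNeg (a + b)
nonneg-+ = ℤP.+-mono-≤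

nonneg-* : ∀ {a b} → NonNeg a → NonNeg b → NonNeg (a * b)
nonneg-* {+ m} {+ n} _ _ = subst NonNeg (ℤP.pos-* m n) (nonneg-ℕ (m ℕ.* n))

-1-negative : ¬ NonNeg (-[1+ 0 ])
-1-negative ()

nonneg-neg : ∀ m → NonNeg (- + m) → m ≡ 0
nonneg-neg zero _ = refl
nonneg-neg (suc m) ()

nonneg-by : ∀ {a b} → a ≡ b → NonNeg b → NonNeg a
nonneg-by a≡b = subst NonNeg (sym a≡b)

≤-by : ∀ {X Y W} → Y - X ≡ W → NonNeg W → X ≤ Y
≤-by gap w = ℤP.0≤i-j⇒j≤i (nonneg-by gap w)

<-by : ∀ {X Y W} → Y - X - + 1 ≡ W → NonNeg W → X < Y
<-by {X} {Y} gap w = ℤP.suc[i]≤j⇒i<j (≤-by (trans (shift Y X) gap) w)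
  where
    shift : ∀ Y X → Y - (+ 1 + X) ≡ Y - X - + 1
    shift = solve-∀

≤-gap : ∀ {X Y} → X ≤ Y → NonNeg (Y - X)
≤-gap = ℤP.i≤j⇒0≤j-i

<-gap : ∀ {X Y} → X < Y → NonNeg (Y - X - + 1)
<-gap {X} {Y} X<Y = nonneg-by (sym (shift Y X)) (≤-gap (ℤP.i<j⇒suc[i]≤j X<Y))
  where
    shift : ∀ Y X → Y - (+ 1 + X) ≡ Y - X - + 1
    shift = solve-∀

pred<⇒≤ : ∀ {a b} → a - + 1 < b → a ≤ b
pred<⇒≤ {a} {b} a-1<b = subst (_≤ b) (step a) (ℤP.i<j⇒suc[i]≤j a-1<b)
  where
    step : ∀ a → + 1 + (a - + 1) ≡ a
    step = solve-∀

*-cancel-< : ∀ a {u v} → + 0 < a → a * u < a * v → u < v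
*-cancel-< a 0<a = ℤP.*-cancelˡ-<-nonNeg a {{ℤ.nonNegative (ℤP.<⇒≤ 0<a)}}

*-cancel-≤ : ∀ a {u v} → + 0 < a → a * u ≤ a * v → u ≤ v
*-cancel-≤ a {u} {v} 0<a = ℤP.*-cancelˡ-≤-pos u v a {{ℤ.positive 0<a}}

divmod-unique : ∀ d {c c' e e'} → e ℕ.≤ d → e' ℕ.≤ d →
                e ℕ.+ c ℕ.* suc d ≡ e' ℕ.+ c' ℕ.* suc d → c ≡ c' × e ≡ e'
divmod-unique d {c} {c'} {e} {e'} e≤d e'≤d eq = c≡c' , e≡e'
  where
    open ≡-Reasoning
    e≡e' : e ≡ e'
    e≡e' = begin
      e                          ≡⟨ m≤n⇒m%n≡m e≤d ⟨
      e % suc d                  ≡⟨ [m+kn]%n≡m%n e c (suc d) ⟨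
      (e ℕ.+ c ℕ.* suc d) % suc d   ≡⟨ cong (_% suc d) eq ⟩
      (e' ℕ.+ c' ℕ.* suc d) % suc d ≡⟨ [m+kn]%n≡m%n e' c' (suc d) ⟩
      e' % suc d                 ≡⟨ m≤n⇒m%n≡m e'≤d ⟩
      e'                         ∎
    c≡c' : c ≡ c'
    c≡c' = ℕP.*-cancelʳ-≡ c c' (suc d)
             (ℕP.+-cancelˡ-≡ e _ _ (trans eq (cong (λ r → r ℕ.+ c' ℕ.* suc d) (sym e≡e'))))

interval : ℤ → ℕ → List ℤ
interval a n = map (λ m → a + + m) (upTo n)

∈-interval⁻ : ∀ a n {y} → y ∈ interval a n → a ≤ y × y < a + + n
∈-interval⁻ a n y∈ with ∈-map⁻ (λ m → a + + m) y∈
... | m , m∈ , refl = ℤP.i≤i+j a (+ m) , ℤP.+-monoʳ-< a (+<+ (∈-upTo⁻ m∈))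

∈-interval⁺ : ∀ {a n y} → a ≤ y → y < a + + n → y ∈ interval a n
∈-interval⁺ {a} {n} {y} a≤y y<a+n =
  subst (_∈ interval a n) a+m≡y (∈-map⁺ (λ m → a + + m) (∈-upTo⁺ (ℤP.drop‿+<+ m<n)))
  where
    m : ℕ
    m = ℤ.∣ y - a ∣
    y-a≡m : + m ≡ y - a
    y-a≡m = ℤP.0≤i⇒+∣i∣≡i (≤-gap a≤y)
    a+m≡y : a + + m ≡ y
    a+m≡y = trans (cong (λ t → a + t) y-a≡m) (cancel a y)
      where
        cancel : ∀ a y → a + (y - a) ≡ y
        cancel = solve-∀
    m<n : + m < + n
    m<n = <-by (trans (cong (λ t → + n - t - + 1) y-a≡m) (gap a y (+ n))) (<-gap y<a+n)
      where
        gap : ∀ a y n → n - (y - a) - + 1 ≡ a + n - y - + 1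
        gap = solve-∀

interval-unique : ∀ a n → Unique (interval a n)
interval-unique a n = Unique.map⁺ (λ eq → ℤP.+-injective (+-cancelˡ a eq)) (Unique.upTo⁺ n)
  where
    +-cancelˡ : ∀ a {u v} → a + u ≡ a + v → u ≡ v
    +-cancelˡ a {u} {v} eq = trans (undo a u) (trans (cong (λ t → t - a) eq) (sym (undo a v)))
      where
        undo : ∀ a u → u ≡ a + u - a
        undo = solve-∀

length-interval : ∀ a n → length (interval a n) ≡ n
length-interval a n = trans (length-map _ (upTo n)) (length-upTo n)

sumUpTo : (ℕ → ℕ) → ℕ → ℕ
sumUpTo f zero = 0
sumUpTo f (suc n) = sumUpTo f n ℕ.+ f n

sumUpTo-cong : ∀ {f g} n → (∀ c → c ℕ.< n → f c ≡ g c) → sumUpTo f n ≡ sumUpTo g n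
sumUpTo-cong zero f≡g = refl
sumUpTo-cong (suc n) f≡g =
  cong₂ ℕ._+_ (sumUpTo-cong n (λ c c<n → f≡g c (ℕP.m<n⇒m<1+n c<n))) (f≡g n (ℕP.n<1+n n))

sumUpTo-+ : ∀ f g n → sumUpTo f n ℕ.+ sumUpTo g n ≡ sumUpTo (λ c → f c ℕ.+ g c) n
sumUpTo-+ f g zero = refl
sumUpTo-+ f g (suc n) =
  trans (+-interchange (sumUpTo f n) (f n) (sumUpTo g n) (g n))
        (cong (ℕ._+ (f n ℕ.+ g n)) (sumUpTo-+ f g n))

sumUpTo-*ʳ : ∀ f a n → sumUpTo (λ c → f c ℕ.* a) n ≡ sumUpTo f n ℕ.* a
sumUpTo-*ʳ f a zero = refl
sumUpTo-*ʳ f a (suc n) =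
  trans (cong (ℕ._+ f n ℕ.* a) (sumUpTo-*ʳ f a n)) (sym (ℕP.*-distribʳ-+ a (sumUpTo f n) (f n)))

sumUpTo-const : ∀ a n → sumUpTo (λ _ → a) n ≡ n ℕ.* a
sumUpTo-const a zero = refl
sumUpTo-const a (suc n) = trans (cong (ℕ._+ a) (sumUpTo-const a n)) (ℕP.+-comm (n ℕ.* a) a)

module _ {A : Set} where

  concatUpTo : (ℕ → List A) → ℕ → List A
  concatUpTo f zero = []
  concatUpTo f (suc n) = concatUpTo f n ++ f n

  ∈-concatUpTo⁻ : ∀ f n {y} → y ∈ concatUpTo f n → Σ ℕ λ c → c ℕ.< n × y ∈ f c
  ∈-concatUpTo⁻ f (suc n) y∈ with ∈-++⁻ (concatUpTo f n) y∈
  ... | inj₂ y∈fn = n , ℕP.n<1+n n , y∈fn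
  ... | inj₁ y∈init with ∈-concatUpTo⁻ f n y∈init
  ...   | c , c<n , y∈fc = c , ℕP.m<n⇒m<1+n c<n , y∈fc

  ∈-concatUpTo⁺ : ∀ f {n c y} → c ℕ.< n → y ∈ f c → y ∈ concatUpTo f n
  ∈-concatUpTo⁺ f {suc n} {c} c<1+n y∈fc with c ℕ.≟ n
  ... | yes refl = ∈-++⁺ʳ (concatUpTo f n) y∈fc
  ... | no c≢n = ∈-++⁺ˡ (∈-concatUpTo⁺ f (ℕP.≤∧≢⇒< (ℕP.≤-pred c<1+n) c≢n) y∈fc)

  concatUpTo-unique : ∀ (key : A → ℕ) f n → (∀ c → c ℕ.< n → Unique (f c)) →
                      (∀ {c y} → c ℕ.< n → y ∈ f c → key y ≡ c) → Unique (concatUpTo f n)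
  concatUpTo-unique key f zero _ _ = []
  concatUpTo-unique key f (suc n) unique keyed =
    Unique.++⁺ (concatUpTo-unique key f n (λ c c<n → unique c (ℕP.m<n⇒m<1+n c<n))
                                          (λ c<n → keyed (ℕP.m<n⇒m<1+n c<n)))
               (unique n (ℕP.n<1+n n)) disjoint
    where
      disjoint : ∀ {v} → ¬ (v ∈ concatUpTo f n × v ∈ f n)
      disjoint (v∈init , v∈fn) with ∈-concatUpTo⁻ f n v∈init
      ... | c , c<n , v∈fc =
        ℕP.<⇒≢ c<n (trans (sym (keyed (ℕP.m<n⇒m<1+n c<n) v∈fc)) (keyed (ℕP.n<1+n n) v∈fn))

  length-concatUpTo : ∀ f n {len : ℕ → ℕ} → (∀ c → c ℕ.< n → length (f c) ≡ len c) →
                      length (concatUpTo f n) ≡ sumUpTo len n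
  length-concatUpTo f zero _ = refl
  length-concatUpTo f (suc n) lengths =
    trans (length-++ (concatUpTo f n))
          (cong₂ ℕ._+_ (length-concatUpTo f n (λ c c<n → lengths c (ℕP.m<n⇒m<1+n c<n)))
                       (lengths n (ℕP.n<1+n n)))

  map-unique-on : ∀ {B : Set} (f : A → B) {xs} → Unique xs →
                  (∀ {a b} → a ∈ xs → b ∈ xs → f a ≡ f b → a ≡ b) → Unique (map f xs)
  map-unique-on f {[]} _ _ = []
  map-unique-on f {x ∷ xs} (x∉xs ∷ unique) inj =
    All.tabulate fresh ∷ map-unique-on f unique (λ a∈ b∈ → inj (there a∈) (there b∈))
    where
      fresh : ∀ {z} → z ∈ map f xs → f x ≢ z
      fresh z∈ fx≡z with ∈-map⁻ f z∈
      ... | b , b∈ , refl = All.lookup x∉xs b∈ (inj (here refl) (there b∈) fx≡z)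

  hasCard-image : ∀ {B : Set} {P : B → Set} (f : A → B) (L : List A) → Unique L →
                  (∀ {a b} → a ∈ L → b ∈ L → f a ≡ f b → a ≡ b) →
                  (∀ {a} → a ∈ L → P (f a)) →
                  (∀ {y} → P y → Σ A λ a → a ∈ L × y ≡ f a) →
                  HasCard P (length L)
  hasCard-image {P = P} f L unique inj sound complete =
    map f L , map-unique-on f unique inj , (λ y → mk⇔ to from) , length-map f L
    where
      to : ∀ {y} → y ∈ map f L → P y
      to y∈ with ∈-map⁻ f y∈
      ... | a , a∈ , refl = sound a∈
      from : ∀ {y} → P y → y ∈ map f L
      from Py with complete Py
      ... | a , a∈ , refl = ∈-map⁺ f a∈

sumℤ-replicate : ∀ n y → sumℤ (replicate n y) ≡ + n * y
sumℤ-replicate zero y = sym (ℤP.*-zeroˡ y)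
sumℤ-replicate (suc n) y = trans (cong (λ s → y + s) (sumℤ-replicate n y)) (step (+ n) y)
  where
    step : ∀ n y → y + n * y ≡ (+ 1 + n) * y
    step = solve-∀

AllPair-replicate : ∀ {R : ℤ → ℤ → Set} n {a b} → R a b → AllPair R (replicate n a) (replicate n b)
AllPair-replicate zero Rab = tt
AllPair-replicate (suc n) Rab = Rab , AllPair-replicate n Rab

AllPair-functional : ∀ {R : ℤ → ℤ → Set} {a w} → (∀ {y z} → R a y → R a z → y ≡ z) → R a w →
                     ∀ {n} (v : Vec ℤ n) → AllPair R (replicate n a) v → v ≡ replicate n w
AllPair-functional functional Raw [] _ = refl
AllPair-functional functional Raw (y ∷ v) (Ray , rest) =
  cong₂ _∷_ (functional Ray Raw) (AllPair-functional functional Raw v rest)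

-- A map of slope Q ≥ 0 cannot take values in a window [L, L + Q) at two
-- points y < z: their values differ by at least Q.
window-separated : ∀ {Q L} (f : ℤ → ℤ) → NonNeg Q → (∀ y z → f y - f z ≡ Q * (y - z)) →
                   ∀ {y z} → y < z → L ≤ f y → f z < L + Q → ⊥
window-separated {Q} {L} f Q≥0 slope {y} {z} y<z L≤fy fz<L+Q =
  -1-negative (nonneg-by (sym certificate)
             (nonneg-+ (nonneg-+ (≤-gap L≤fy) (nonneg-* Q≥0 (<-gap y<z))) (<-gap fz<L+Q)))
  where
    open ≡-Reasoning
    regroup : ∀ Q L fy fz y z →
              (fy - L) + Q * (z - y - + 1) + (L + Q - fz - + 1) ≡ (fy - fz) - Q * (y - z) - + 1
    regroup = solve-∀
    cancel : ∀ Q y z → Q * (y - z) - Q * (y - z) - + 1 ≡ -[1+ 0 ]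
    cancel = solve-∀
    certificate : (f y - L) + Q * (z - y - + 1) + (L + Q - f z - + 1) ≡ -[1+ 0 ]
    certificate = begin
      (f y - L) + Q * (z - y - + 1) + (L + Q - f z - + 1) ≡⟨ regroup Q L (f y) (f z) y z ⟩
      (f y - f z) - Q * (y - z) - + 1                      ≡⟨ cong (λ d → d - Q * (y - z) - + 1) (slope y z) ⟩
      Q * (y - z) - Q * (y - z) - + 1                      ≡⟨ cancel Q y z ⟩
      -[1+ 0 ]                                           ∎

window-unique : ∀ {Q L} (f : ℤ → ℤ) → NonNeg Q → (∀ y z → f y - f z ≡ Q * (y - z)) →
                ∀ {y z} → L ≤ f y × f y < L + Q → L ≤ f z × f z < L + Q → y ≡ z
window-unique f Q≥0 slope {y} {z} (L≤fy , fy<) (L≤fz , fz<) with ℤP.<-cmp y z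
... | tri≈ _ y≡z _ = y≡z
... | tri< y<z _ _ = ⊥-elim (window-separated f Q≥0 slope y<z L≤fy fz<)
... | tri> _ _ z<y = ⊥-elim (window-separated f Q≥0 slope z<y L≤fz fy<)

module Parametrisation (q : ℕ) (1≤q : 1 ℕ.≤ q) where

  x Q : ℤ
  x = + q
  Q = x * x + x

  x≥0 : NonNeg x
  x≥0 = nonneg-ℕ q

  x+1≥0 : NonNeg (x + + 1)
  x+1≥0 = nonneg-ℕ (q ℕ.+ 1)

  Q≥0 : NonNeg Q
  Q≥0 = nonneg-+ (nonneg-* x≥0 x≥0) x≥0

  0<x+1 : + 0 < x + + 1
  0<x+1 = +<+ (ℕP.<-≤-trans 1≤q (ℕP.m≤m+n q 1))

  0<x : + 0 < x
  0<x = +<+ 1≤q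

  0<Q : + 0 < Q
  0<Q = <-by (gap x) (nonneg-+ (nonneg-* x≥0 x≥0) (<-gap 0<x))
    where
      gap : ∀ X → (X * X + X) - + 0 - + 1 ≡ X * X + (X - + 0 - + 1)
      gap = solve-∀

  record Param : Set where
    constructor param
    field
      c e : ℕ
      k σ : ℤ

  I J : Param → ℤ
  I (param c e k σ) = (x + + 1) * + c + + e - Q * k
  J (param c e k σ) = (x + + 1) * k + σ - + c

  -- At the point with parameters p, qi + Qj - (q+1)Σk equals M p, and the
  -- u-condition reads G p ≤ qQ.
  M G : Param → ℤ
  M (param c e k σ) = x * + e + Q * σ + (x + + 1) * k
  G (param c e k σ) = Q * + c + x * x * + e - (x + + 1) * k + x * (x * x - + 1) * σ

  -- The parameters of the points of Ω (c < q and e ≤ q say that (q+1)c + e is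
  -- the base-(q+1) expansion of the residue i + Qk ∈ [0, Q)).
  record Admissible (p : Param) : Set where
    constructor admissible
    field
      c<q  : Param.c p ℕ.< q
      e≤q  : Param.e p ℕ.≤ q
      k<q  : Param.k p < x
      M≥0  : + 0 ≤ M p
      M<Q  : M p < Q
      G≤qQ : G p ≤ x * Q

  -- The conditions of Ω (s = t = 0, r = q³ - q, u = q³ + q²) on a point
  -- (i, (j,…,j), (k,…,k)), in the form they take in `InΩ`, with S and T
  -- standing for Σk and Σj.
  KWindow : ℤ → ℤ → Set
  KWindow i k = (- + 0 ≤ i + Q * k) × (i + Q * k < - + 0 + Q)

  JWindow : ℤ → ℤ → ℤ → Set
  JWindow i j S = (- + 0 ≤ x * i + Q * j - (x + + 1) * S) × (x * i + Q * j - (x + + 1) * S < - + 0 + Q)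

  UBound : ℤ → ℤ → ℤ → Set
  UBound i T S = - (x * x * x + x * x) ≤ - (x * x) * i - Q * T - (x + + 1) * S

  record ΩConditions (i j k : ℤ) : Set where
    constructor conditions
    field
      i-bound  : - (x * x * x - x) ≤ i
      k-window : KWindow i k
      j-window : JWindow i j ((x - + 1) * k)
      u-bound  : UBound i ((x - + 1) * j) ((x - + 1) * k)

  -- Ring identities translating the j-window and u-conditions at the point with
  -- parameters p into bounds on M p and G p (X = q, C = c, E = e).
  private
    j-lower-gap : ∀ X C E k σ →
      X * ((X + + 1) * C + E - (X * X + X) * k) + (X * X + X) * ((X + + 1) * k + σ - C)
        - (X + + 1) * ((X - + 1) * k) - (- + 0)
      ≡ X * E + (X * X + X) * σ + (X + + 1) * k - + 0
    j-lower-gap = solve-∀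

    j-upper-gap : ∀ X C E k σ →
      (- + 0 + (X * X + X)) - (X * ((X + + 1) * C + E - (X * X + X) * k)
        + (X * X + X) * ((X + + 1) * k + σ - C) - (X + + 1) * ((X - + 1) * k)) - + 1
      ≡ (X * X + X) - (X * E + (X * X + X) * σ + (X + + 1) * k) - + 1
    j-upper-gap = solve-∀

    u-gap : ∀ X C E k σ →
      (- (X * X) * ((X + + 1) * C + E - (X * X + X) * k)
        - (X * X + X) * ((X - + 1) * ((X + + 1) * k + σ - C)) - (X + + 1) * ((X - + 1) * k))
        - (- (X * X * X + X * X))
      ≡ X * (X * X + X) - ((X * X + X) * C + X * X * E - (X + + 1) * k + X * (X * X - + 1) * σ)
    u-gap = solve-∀

  admissible⇒conditions : ∀ {p} → Admissible p → ΩConditions (I p) (J p) (Param.k p)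
  admissible⇒conditions {param c e k σ} (admissible c<q e≤q k<q M≥0 M<Q G≤qQ) =
    conditions
      (≤-by (i-gap x (+ c) (+ e) k)
            (nonneg-+ (nonneg-+ (nonneg-* x+1≥0 (nonneg-ℕ c)) (nonneg-ℕ e)) (nonneg-* Q≥0 (<-gap k<q))))
      (≤-by (residue-lower x (+ c) (+ e) k) (nonneg-+ (nonneg-* x+1≥0 (nonneg-ℕ c)) (nonneg-ℕ e)) ,
       <-by (residue-upper x (+ c) (+ e) k)
            (nonneg-+ (nonneg-* x+1≥0 (<-gap (+<+ c<q))) (≤-gap (+≤+ e≤q))))
      (≤-by (j-lower-gap x (+ c) (+ e) k σ) (≤-gap M≥0) ,
       <-by (j-upper-gap x (+ c) (+ e) k σ) (<-gap M<Q))
      (≤-by (u-gap x (+ c) (+ e) k σ) (≤-gap G≤qQ))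
    where
      i-gap : ∀ X C E k → ((X + + 1) * C + E - (X * X + X) * k) - (- (X * X * X - X))
                          ≡ (X + + 1) * C + E + (X * X + X) * (X - k - + 1)
      i-gap = solve-∀
      residue-lower : ∀ X C E k → ((X + + 1) * C + E - (X * X + X) * k + (X * X + X) * k) - (- + 0)
                                  ≡ (X + + 1) * C + E
      residue-lower = solve-∀
      residue-upper : ∀ X C E k →
        (- + 0 + (X * X + X)) - ((X + + 1) * C + E - (X * X + X) * k + (X * X + X) * k) - + 1
        ≡ (X + + 1) * (X - C - + 1) + (X - E)
      residue-upper = solve-∀

  conditions⇒admissible : ∀ {p} → Param.c p ℕ.< q → Param.e p ℕ.≤ q →
                          ΩConditions (I p) (J p) (Param.k p) → Admissible p
  conditions⇒admissible {param c e k σ} c<q e≤q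
                        (conditions i-bound (_ , residue<Q) (j-lower , j-upper) u-bound) =
    admissible c<q e≤q
      (*-cancel-< Q 0<Q (<-by (k-gap x (I (param c e k σ)) k) (nonneg-+ (≤-gap i-bound) (<-gap residue<Q))))
      (≤-by (sym (j-lower-gap x (+ c) (+ e) k σ)) (≤-gap j-lower))
      (<-by (sym (j-upper-gap x (+ c) (+ e) k σ)) (<-gap j-upper))
      (≤-by (sym (u-gap x (+ c) (+ e) k σ)) (≤-gap u-bound))
    where
      k-gap : ∀ X i k → (X * X + X) * X - (X * X + X) * k - + 1
                        ≡ (i - - (X * X * X - X)) + ((- + 0 + (X * X + X)) - (i + (X * X + X) * k) - + 1)
      k-gap = solve-∀

  expansion : ∀ c e → (x + + 1) * + c + + e ≡ + (e ℕ.+ c ℕ.* suc q)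
  expansion c e = begin
    (x + + 1) * + c + + e     ≡⟨ reorder x (+ c) (+ e) ⟩
    + e + + c * + suc q       ≡⟨ cong (λ t → + e + t) (ℤP.pos-* c (suc q)) ⟨
    + e + + (c ℕ.* suc q)     ≡⟨ ℤP.pos-+ e (c ℕ.* suc q) ⟨
    + (e ℕ.+ c ℕ.* suc q)     ∎
    where
      open ≡-Reasoning
      reorder : ∀ X C E → (X + + 1) * C + E ≡ E + C * (+ 1 + X)
      reorder = solve-∀

  digits : ∀ b → (x + + 1) * + (b / suc q) + + (b % suc q) ≡ + b
  digits b = trans (expansion (b / suc q) (b % suc q)) (cong +_ (sym (m≡m%n+[m/n]*n b (suc q))))

  residue : ℤ → ℤ → ℕ
  residue i k = ℤ.∣ i + Q * k ∣

  paramOf : ℤ → ℤ → ℤ → Param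
  paramOf i j k = param c (residue i k % suc q) k (j + + c - (x + + 1) * k)
    where
      c : ℕ
      c = residue i k / suc q

  paramOf-I : ∀ {i j k} → KWindow i k → I (paramOf i j k) ≡ i
  paramOf-I {i} {j} {k} (residue≥0 , _) = begin
    (x + + 1) * + c + + e - Q * k   ≡⟨ cong (λ b → b - Q * k) (digits (residue i k)) ⟩
    + residue i k - Q * k           ≡⟨ cong (λ b → b - Q * k) (ℤP.0≤i⇒+∣i∣≡i residue≥0) ⟩
    i + Q * k - Q * k               ≡⟨ undo i (Q * k) ⟩
    i                               ∎
    where
      open ≡-Reasoning
      c e : ℕ
      c = residue i k / suc q
      e = residue i k % suc q
      undo : ∀ i t → i + t - t ≡ i
      undo = solve-∀

  paramOf-J : ∀ i j k → J (paramOf i j k) ≡ j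
  paramOf-J i j k = recover x (+ (residue i k / suc q)) k j
    where
      recover : ∀ X C k j → (X + + 1) * k + (j + C - (X + + 1) * k) - C ≡ j
      recover = solve-∀

  paramOf-c<q : ∀ {i j k} → KWindow i k → Param.c (paramOf i j k) ℕ.< q
  paramOf-c<q {i} {j} {k} (residue≥0 , residue<Q) =
    m<n*o⇒m/o<n (ℤP.drop‿+<+ (subst₂ _<_ (sym (ℤP.0≤i⇒+∣i∣≡i residue≥0)) Q≡ residue<Q))
    where
      Q≡ : - + 0 + Q ≡ + (q ℕ.* suc q)
      Q≡ = trans (factor x) (sym (ℤP.pos-* q (suc q)))
        where
          factor : ∀ X → - + 0 + (X * X + X) ≡ X * (+ 1 + X)
          factor = solve-∀

  paramOf-e≤q : ∀ i j k → Param.e (paramOf i j k) ℕ.≤ q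
  paramOf-e≤q i j k = ℕ.s≤s⁻¹ (m%n<n (residue i k) (suc q))

  same-residue : ∀ {c e c' e' k k' σ σ'} → I (param c e k σ) ≡ I (param c' e' k' σ') → k ≡ k' →
                 e ℕ.+ c ℕ.* suc q ≡ e' ℕ.+ c' ℕ.* suc q
  same-residue {c} {e} {c'} {e'} {k} {k'} {σ} {σ'} I≡I' refl = ℤP.+-injective (begin
    + (e ℕ.+ c ℕ.* suc q)                     ≡⟨ expansion c e ⟨
    (x + + 1) * + c + + e                     ≡⟨ add-back x (+ c) (+ e) k ⟩
    I (param c e k σ) + Q * k                 ≡⟨ cong (λ i → i + Q * k) I≡I' ⟩
    I (param c' e' k σ') + Q * k              ≡⟨ add-back x (+ c') (+ e') k ⟨
    (x + + 1) * + c' + + e'                   ≡⟨ expansion c' e' ⟩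
    + (e' ℕ.+ c' ℕ.* suc q)                   ∎)
    where
      open ≡-Reasoning
      add-back : ∀ X C E k → (X + + 1) * C + E ≡ ((X + + 1) * C + E - (X * X + X) * k) + (X * X + X) * k
      add-back = solve-∀

  same-σ : ∀ {c k σ σ'} → J (param c 0 k σ) ≡ J (param c 0 k σ') → σ ≡ σ'
  same-σ {c} {k} {σ} {σ'} J≡J' = begin
    σ                                         ≡⟨ recover x k σ (+ c) ⟩
    J (param c 0 k σ) - (x + + 1) * k + + c   ≡⟨ cong (λ j → j - (x + + 1) * k + + c) J≡J' ⟩
    J (param c 0 k σ') - (x + + 1) * k + + c  ≡⟨ recover x k σ' (+ c) ⟨
    σ'                                        ∎
    where
      open ≡-Reasoning
      recover : ∀ X k σ C → σ ≡ ((X + + 1) * k + σ - C) - (X + + 1) * k + C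
      recover = solve-∀

  data Family : Param → Set where
    σ=1     : ∀ {k} → k ∈ interval (- x) q → Family (param 0 0 k (+ 1))
    σ=0,e=0 : ∀ {c k} → c ℕ.< q → k ∈ interval (+ 0) q → Family (param c 0 k (+ 0))
    σ=0,e>0 : ∀ {c e k} → c ℕ.< q → e ℕ.< q ∸ c → k ∈ interval (- + e) q →
              Family (param c (suc e) k (+ 0))
    σ=-1    : ∀ {c e k} → c ℕ.< q → e ℕ.< q → k ∈ interval (x - + e) e →
              Family (param c (suc e) k -[1+ 0 ])

  family⇒admissible : ∀ {p} → Family p → Admissible p
  family⇒admissible (σ=1 {k} k∈) with ∈-interval⁻ (- x) q k∈
  ... | lo , hi =
    admissible 1≤q z≤n
      (<-by (k-gap x k) (nonneg-+ (<-gap hi) x≥0))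
      (≤-by (M-gap x k) (nonneg-* x+1≥0 (≤-gap lo)))
      (<-by (Q-M-gap x k) (nonneg-+ (nonneg-* x+1≥0 (<-gap hi)) x≥0))
      (≤-by (G-gap x k) (nonneg-* x+1≥0 (≤-gap lo)))
    where
      k-gap : ∀ X k → X - k - + 1 ≡ (- X + X - k - + 1) + X
      k-gap = solve-∀
      M-gap : ∀ X k → X * + 0 + (X * X + X) * + 1 + (X + + 1) * k - + 0 ≡ (X + + 1) * (k - - X)
      M-gap = solve-∀
      Q-M-gap : ∀ X k → (X * X + X) - (X * + 0 + (X * X + X) * + 1 + (X + + 1) * k) - + 1
                        ≡ (X + + 1) * (- X + X - k - + 1) + X
      Q-M-gap = solve-∀
      G-gap : ∀ X k → X * (X * X + X) - ((X * X + X) * + 0 + X * X * + 0 - (X + + 1) * k + X * (X * X - + 1) * + 1)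
                      ≡ (X + + 1) * (k - - X)
      G-gap = solve-∀
  family⇒admissible (σ=0,e=0 {c} {k} c<q k∈) with ∈-interval⁻ (+ 0) q k∈
  ... | lo , hi =
    admissible c<q z≤n
      (<-by (k-gap x k) (<-gap hi))
      (≤-by (M-gap x k) (nonneg-* x+1≥0 (≤-gap lo)))
      (<-by (Q-M-gap x k) (nonneg-+ (nonneg-* x+1≥0 (<-gap hi)) x≥0))
      (≤-by (G-gap x (+ c) k) (nonneg-+ (nonneg-* Q≥0 (nonneg-+ (<-gap (+<+ c<q)) (nonneg-ℕ 1)))
                                        (nonneg-* x+1≥0 (≤-gap lo))))
    where
      k-gap : ∀ X k → X - k - + 1 ≡ + 0 + X - k - + 1
      k-gap = solve-∀
      M-gap : ∀ X k → X * + 0 + (X * X + X) * + 0 + (X + + 1) * k - + 0 ≡ (X + + 1) * (k - + 0)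
      M-gap = solve-∀
      Q-M-gap : ∀ X k → (X * X + X) - (X * + 0 + (X * X + X) * + 0 + (X + + 1) * k) - + 1
                        ≡ (X + + 1) * (+ 0 + X - k - + 1) + X
      Q-M-gap = solve-∀
      G-gap : ∀ X C k → X * (X * X + X) - ((X * X + X) * C + X * X * + 0 - (X + + 1) * k + X * (X * X - + 1) * + 0)
                        ≡ (X * X + X) * (X - C - + 1 + + 1) + (X + + 1) * (k - + 0)
      G-gap = solve-∀
  family⇒admissible (σ=0,e>0 {c} {e} {k} c<q e<q-c k∈) with ∈-interval⁻ (- + e) q k∈
  ... | lo , hi =
    admissible c<q e+1≤q
      (<-by (k-gap x k (+ e)) (nonneg-+ (<-gap hi) (nonneg-ℕ e)))
      (≤-by (M-gap x (+ e) k) (nonneg-+ (nonneg-* x+1≥0 (≤-gap lo)) (nonneg-+ (≤-gap (+≤+ e+1≤q)) (nonneg-ℕ 1))))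
      (<-by (Q-M-gap x (+ e) k) (nonneg-+ (nonneg-* x+1≥0 (<-gap hi)) (nonneg-ℕ e)))
      (≤-by (G-gap x (+ c) (+ e) k)
            (nonneg-+ (nonneg-+ (nonneg-+ (nonneg-* Q≥0 spare) (nonneg-* x+1≥0 (≤-gap lo))) spare) (nonneg-ℕ (suc c))))
    where
      c+e+1≤q : c ℕ.+ suc e ℕ.≤ q
      c+e+1≤q = subst (ℕ._≤ q) (ℕP.+-comm (suc e) c) (ℕP.m≤o∸n⇒m+n≤o (suc e) (ℕP.<⇒≤ c<q) e<q-c)
      e+1≤q : suc e ℕ.≤ q
      e+1≤q = ℕP.≤-trans e<q-c (ℕP.m∸n≤m q c)
      spare : NonNeg (x - (+ c + + suc e))
      spare = ≤-gap (+≤+ c+e+1≤q)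
      k-gap : ∀ X k E → X - k - + 1 ≡ (- E + X - k - + 1) + E
      k-gap = solve-∀
      M-gap : ∀ X E k → X * (+ 1 + E) + (X * X + X) * + 0 + (X + + 1) * k - + 0
                        ≡ (X + + 1) * (k - - E) + ((X - (+ 1 + E)) + + 1)
      M-gap = solve-∀
      Q-M-gap : ∀ X E k → (X * X + X) - (X * (+ 1 + E) + (X * X + X) * + 0 + (X + + 1) * k) - + 1
                          ≡ (X + + 1) * (- E + X - k - + 1) + E
      Q-M-gap = solve-∀
      G-gap : ∀ X C E k →
        X * (X * X + X) - ((X * X + X) * C + X * X * (+ 1 + E) - (X + + 1) * k + X * (X * X - + 1) * + 0)
        ≡ (X * X + X) * (X - (C + (+ 1 + E))) + (X + + 1) * (k - - E) + (X - (C + (+ 1 + E))) + (+ 1 + C)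
      G-gap = solve-∀
  family⇒admissible (σ=-1 {c} {e} {k} c<q e<q k∈) with ∈-interval⁻ (x - + e) e k∈
  ... | lo , hi =
    admissible c<q e<q
      (<-by (k-gap x (+ e) k) (<-gap hi))
      (≤-by (M-gap x (+ e) k) (nonneg-+ (nonneg-* x+1≥0 (≤-gap lo)) (nonneg-+ q-e-1 (nonneg-ℕ 1))))
      (<-by (Q-M-gap x (+ e) k) (nonneg-+ (nonneg-* x+1≥0 (<-gap hi)) (nonneg-* x≥0 (nonneg-+ q-e-1 (nonneg-ℕ 2)))))
      (≤-by (G-gap x (+ c) (+ e) k)
            (nonneg-+ (nonneg-+ (nonneg-+ (nonneg-* Q≥0 (<-gap (+<+ c<q)))
                                          (nonneg-* (nonneg-* x≥0 x≥0) (nonneg-+ q-e-1 (nonneg-ℕ 1))))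
                                (nonneg-* x+1≥0 (≤-gap lo)))
                      (nonneg-* x+1≥0 (nonneg-+ q-e-1 (nonneg-ℕ 1)))))
    where
      q-e-1 : NonNeg (x - + e - + 1)
      q-e-1 = <-gap (+<+ e<q)
      k-gap : ∀ X E k → X - k - + 1 ≡ X - E + E - k - + 1
      k-gap = solve-∀
      M-gap : ∀ X E k → X * (+ 1 + E) + (X * X + X) * -[1+ 0 ] + (X + + 1) * k - + 0
                        ≡ (X + + 1) * (k - (X - E)) + (X - E - + 1 + + 1)
      M-gap = solve-∀
      Q-M-gap : ∀ X E k → (X * X + X) - (X * (+ 1 + E) + (X * X + X) * -[1+ 0 ] + (X + + 1) * k) - + 1
                          ≡ (X + + 1) * (X - E + E - k - + 1) + X * (X - E - + 1 + + 2)
      Q-M-gap = solve-∀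
      G-gap : ∀ X C E k →
        X * (X * X + X) - ((X * X + X) * C + X * X * (+ 1 + E) - (X + + 1) * k + X * (X * X - + 1) * -[1+ 0 ])
        ≡ (X * X + X) * (X - C - + 1) + X * X * (X - E - + 1 + + 1) + (X + + 1) * (k - (X - E))
          + (X + + 1) * (X - E - + 1 + + 1)
      G-gap = solve-∀

  -- Adding M < Q and G ≤ qQ gives Q(c + e + qσ) < Q(q + 1): the budget
  -- c + e + qσ ≤ q.  It bounds σ ≤ 1 and, for σ = 0, c + e ≤ q.
  budget : ∀ {c e k σ} → Admissible (param c e k σ) → NonNeg (x - + c - + e - x * σ)
  budget {c} {e} {k} {σ} (admissible _ _ _ _ M<Q G≤qQ) =
    nonneg-by (sym (shift x (+ c) (+ e) σ)) (<-gap total<q+1)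
    where
      sum-gap : ∀ X C E k σ →
        (X * X + X) * (X + + 1) - (X * X + X) * (C + E + X * σ) - + 1
        ≡ (X * (X * X + X) - ((X * X + X) * C + X * X * E - (X + + 1) * k + X * (X * X - + 1) * σ))
          + ((X * X + X) - (X * E + (X * X + X) * σ + (X + + 1) * k) - + 1)
      sum-gap = solve-∀
      shift : ∀ X C E σ → X + + 1 - (C + E + X * σ) - + 1 ≡ X - C - E - X * σ
      shift = solve-∀
      total<q+1 : + c + + e + x * σ < x + + 1
      total<q+1 = *-cancel-< Q 0<Q (<-by (sum-gap x (+ c) (+ e) k σ) (nonneg-+ (≤-gap G≤qQ) (<-gap M<Q)))

  σ≤1 : ∀ {c e k σ} → Admissible (param c e k σ) → σ ≤ + 1
  σ≤1 {c} {e} {k} {σ} adm =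
    *-cancel-≤ x 0<x
      (≤-by (gap x (+ c) (+ e) σ) (nonneg-+ (nonneg-+ (budget adm) (nonneg-ℕ c)) (nonneg-ℕ e)))
    where
      gap : ∀ X C E σ → X * + 1 - X * σ ≡ (X - C - E - X * σ) + C + E
      gap = solve-∀

  -- M ≥ 0 together with e ≤ q and k < q forces Qσ > -2Q, i.e. σ ≥ -1.
  σ≥-1 : ∀ {c e k σ} → Admissible (param c e k σ) → -[1+ 1 ] < σ
  σ≥-1 {c} {e} {k} {σ} (admissible _ e≤q k<q M≥0 _ _) =
    *-cancel-< Q 0<Q (<-by (gap x (+ e) k σ)
      (nonneg-+ (nonneg-+ (nonneg-+ (nonneg-+ (≤-gap M≥0) (nonneg-* x≥0 (≤-gap (+≤+ e≤q))))
                                    (nonneg-* x+1≥0 (<-gap k<q))) x≥0) x≥0))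
    where
      gap : ∀ X E k σ → (X * X + X) * σ - (X * X + X) * -[1+ 1 ] - + 1
                        ≡ (X * E + (X * X + X) * σ + (X + + 1) * k) - + 0 + X * (X - E)
                          + (X + + 1) * (X - k - + 1) + X + X
      gap = solve-∀

  -- σ = 1 leaves no budget: c = e = 0 ...
  σ=1-origin : ∀ {c e k} → Admissible (param c e k (+ 1)) → c ≡ 0 × e ≡ 0
  σ=1-origin {c} {e} {k} adm = ℕP.m+n≡0⇒m≡0 c c+e≡0 , ℕP.m+n≡0⇒n≡0 c c+e≡0
    where
      no-room : ∀ X C E → X - C - E - X * + 1 ≡ - (C + E)
      no-room = solve-∀
      c+e≡0 : c ℕ.+ e ≡ 0
      c+e≡0 = nonneg-neg (c ℕ.+ e) (nonneg-by (sym (no-room x (+ c) (+ e))) (budget adm))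

  -- ... and then M ∈ [0, Q) puts k in [-q, 0).
  origin-family : ∀ {k} → Admissible (param 0 0 k (+ 1)) → Family (param 0 0 k (+ 1))
  origin-family {k} (admissible _ _ _ M≥0 M<Q _) = σ=1 (∈-interval⁺ k≥-q k<0)
    where
      lo-gap : ∀ X k → (X + + 1) * k - (X + + 1) * (- X) ≡ X * + 0 + (X * X + X) * + 1 + (X + + 1) * k - + 0
      lo-gap = solve-∀
      hi-gap : ∀ X k → (X + + 1) * (- X + X) - (X + + 1) * k - + 1
                       ≡ (X * X + X) - (X * + 0 + (X * X + X) * + 1 + (X + + 1) * k) - + 1
      hi-gap = solve-∀
      k≥-q : - x ≤ k
      k≥-q = *-cancel-≤ (x + + 1) 0<x+1 (≤-by (lo-gap x k) (≤-gap M≥0))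
      k<0 : k < - x + x
      k<0 = *-cancel-< (x + + 1) 0<x+1 (<-by (hi-gap x k) (<-gap M<Q))

  σ=1-family : ∀ {c e k} → Admissible (param c e k (+ 1)) → Family (param c e k (+ 1))
  σ=1-family {c} {e} {k} adm = subst Family origin≡p (origin-family (subst Admissible (sym origin≡p) adm))
    where
      origin≡p : param 0 0 k (+ 1) ≡ param c e k (+ 1)
      origin≡p = sym (cong₂ (λ c′ e′ → param c′ e′ k (+ 1)) (proj₁ (σ=1-origin adm)) (proj₂ (σ=1-origin adm)))

  σ=0-family : ∀ {c e k} → Admissible (param c e k (+ 0)) → Family (param c e k (+ 0))
  σ=0-family {c} {zero} {k} (admissible c<q _ _ M≥0 M<Q _) = σ=0,e=0 c<q (∈-interval⁺ k≥0 k<q)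
    where
      lo-gap : ∀ X k → (X + + 1) * k - (X + + 1) * + 0 ≡ X * + 0 + (X * X + X) * + 0 + (X + + 1) * k - + 0
      lo-gap = solve-∀
      hi-gap : ∀ X k → (X + + 1) * (+ 0 + X) - (X + + 1) * k - + 1
                       ≡ (X * X + X) - (X * + 0 + (X * X + X) * + 0 + (X + + 1) * k) - + 1
      hi-gap = solve-∀
      k≥0 : + 0 ≤ k
      k≥0 = *-cancel-≤ (x + + 1) 0<x+1 (≤-by (lo-gap x k) (≤-gap M≥0))
      k<q : k < + 0 + x
      k<q = *-cancel-< (x + + 1) 0<x+1 (<-by (hi-gap x k) (<-gap M<Q))
  σ=0-family {c} {suc e} {k} adm@(admissible c<q e+1≤q _ M≥0 M<Q _) = σ=0,e>0 c<q e<q-c (∈-interval⁺ k≥-e k<q-e)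
    where
      no-overdraft : ∀ X C E → X - (C + E) ≡ X - C - E - X * + 0
      no-overdraft = solve-∀
      c+e≤q : c ℕ.+ suc e ℕ.≤ q
      c+e≤q = ℤP.drop‿+≤+ (≤-by (no-overdraft x (+ c) (+ suc e)) (budget adm))
      e<q-c : e ℕ.< q ∸ c
      e<q-c = ℕP.m+n≤o⇒m≤o∸n (suc e) (subst (ℕ._≤ q) (ℕP.+-comm c (suc e)) c+e≤q)
      lo-gap : ∀ X E k → (X + + 1) * k - (X + + 1) * (- E - + 1) - + 1
                         ≡ (X * (+ 1 + E) + (X * X + X) * + 0 + (X + + 1) * k - + 0) + E
      lo-gap = solve-∀
      hi-gap : ∀ X E k → (X + + 1) * (- E + X) - (X + + 1) * k - + 1
                         ≡ ((X * X + X) - (X * (+ 1 + E) + (X * X + X) * + 0 + (X + + 1) * k) - + 1)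
                           + (X - (+ 1 + E)) + + 1
      hi-gap = solve-∀
      k≥-e : - + e ≤ k
      k≥-e = pred<⇒≤ (*-cancel-< (x + + 1) 0<x+1 (<-by (lo-gap x (+ e) k) (nonneg-+ (≤-gap M≥0) (nonneg-ℕ e))))
      k<q-e : k < - + e + x
      k<q-e = *-cancel-< (x + + 1) 0<x+1
                (<-by (hi-gap x (+ e) k) (nonneg-+ (nonneg-+ (<-gap M<Q) (≤-gap (+≤+ e+1≤q))) (nonneg-ℕ 1)))

  -- σ = -1: e = 0 would make M negative; e = e' + 1 gives q - e' ≤ k < q.
  σ=-1-family : ∀ {c e k} → Admissible (param c e k -[1+ 0 ]) → Family (param c e k -[1+ 0 ])
  σ=-1-family {c} {zero} {k} (admissible _ _ k<q M≥0 _ _) =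
    ⊥-elim (-1-negative (nonneg-by (sym (deficit x k))
      (nonneg-+ (nonneg-+ (≤-gap M≥0) (nonneg-* x+1≥0 (<-gap k<q))) x≥0)))
    where
      deficit : ∀ X k → (X * + 0 + (X * X + X) * -[1+ 0 ] + (X + + 1) * k - + 0) + (X + + 1) * (X - k - + 1) + X
                        ≡ -[1+ 0 ]
      deficit = solve-∀
  σ=-1-family {c} {suc e} {k} (admissible c<q e<q k<q M≥0 _ _) = σ=-1 c<q e<q (∈-interval⁺ k≥q-e k<q′)
    where
      lo-gap : ∀ X E k → (X + + 1) * k - (X + + 1) * (X - E - + 1) - + 1
                         ≡ (X * (+ 1 + E) + (X * X + X) * -[1+ 0 ] + (X + + 1) * k - + 0) + E
      lo-gap = solve-∀
      hi-gap : ∀ X E k → X - E + E - k - + 1 ≡ X - k - + 1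
      hi-gap = solve-∀
      k≥q-e : x - + e ≤ k
      k≥q-e = pred<⇒≤ (*-cancel-< (x + + 1) 0<x+1 (<-by (lo-gap x (+ e) k) (nonneg-+ (≤-gap M≥0) (nonneg-ℕ e))))
      k<q′ : k < x - + e + + e
      k<q′ = <-by (hi-gap x (+ e) k) (<-gap k<q)

  admissible⇒family : ∀ {p} → Admissible p → Family p
  admissible⇒family {param c e k σ} adm = by-sign σ (σ≥-1 adm) (σ≤1 adm) adm
    where
      by-sign : ∀ σ → -[1+ 1 ] < σ → σ ≤ + 1 → Admissible (param c e k σ) → Family (param c e k σ)
      by-sign (+ 0) _ _ = σ=0-family
      by-sign (+ 1) _ _ = σ=1-family
      by-sign (+ suc (suc _)) _ (+≤+ (s≤s ()))
      by-sign -[1+ 0 ] _ _ = σ=-1-family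
      by-sign -[1+ suc _ ] (-<- (s≤s ())) _

  block : ℕ → ℕ → ℤ → ℤ → ℕ → List Param
  block c e σ a len = map (λ k → param c e k σ) (interval a len)

  block-unique : ∀ c e σ a len → Unique (block c e σ a len)
  block-unique c e σ a len = Unique.map⁺ (cong Param.k) (interval-unique a len)

  ∈block⁺ : ∀ c e σ a len {k} → k ∈ interval a len → param c e k σ ∈ block c e σ a len
  ∈block⁺ c e σ a len = ∈-map⁺ (λ k → param c e k σ)

  ∈block⁻ : ∀ c e σ a len {p} → p ∈ block c e σ a len → Σ ℤ λ k → k ∈ interval a len × p ≡ param c e k σ
  ∈block⁻ c e σ a len = ∈-map⁻ (λ k → param c e k σ)

  ∈block⇒c : ∀ c e σ a len {p} → p ∈ block c e σ a len → Param.c p ≡ c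
  ∈block⇒c c e σ a len p∈ with ∈block⁻ c e σ a len p∈
  ... | _ , _ , refl = refl

  ∈block⇒e : ∀ c e σ a len {p} → p ∈ block c e σ a len → Param.e p ≡ e
  ∈block⇒e c e σ a len p∈ with ∈block⁻ c e σ a len p∈
  ... | _ , _ , refl = refl

  length-block : ∀ c e σ a len → length (block c e σ a len) ≡ len
  length-block c e σ a len = trans (length-map _ (interval a len)) (length-interval a len)

  family : ℕ → List Param
  family 0 = block 0 0 (+ 1) (- x) q
  family 1 = concatUpTo (λ c → block c 0 (+ 0) (+ 0) q) q
  family 2 = concatUpTo (λ c → concatUpTo (λ e → block c (suc e) (+ 0) (- + e) q) (q ∸ c)) q
  family _ = concatUpTo (λ c → concatUpTo (λ e → block c (suc e) -[1+ 0 ] (x - + e) e) q) q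

  params : List Param
  params = concatUpTo family 4

  familyIndex : Param → ℕ
  familyIndex (param _ _ _ (+ 1)) = 0
  familyIndex (param _ zero _ (+ 0)) = 1
  familyIndex (param _ (suc _) _ (+ 0)) = 2
  familyIndex _ = 3

  ∈family⁻ : ∀ t {p} → t ℕ.< 4 → p ∈ family t → Family p × familyIndex p ≡ t
  ∈family⁻ 0 _ p∈ with ∈block⁻ 0 0 (+ 1) (- x) q p∈
  ... | k , k∈ , refl = σ=1 k∈ , refl
  ∈family⁻ 1 _ p∈ with ∈-concatUpTo⁻ (λ c → block c 0 (+ 0) (+ 0) q) q p∈
  ... | c , c<q , p∈c with ∈block⁻ c 0 (+ 0) (+ 0) q p∈c
  ... | k , k∈ , refl = σ=0,e=0 c<q k∈ , refl
  ∈family⁻ 2 _ p∈ with ∈-concatUpTo⁻ (λ c → concatUpTo (λ e → block c (suc e) (+ 0) (- + e) q) (q ∸ c)) q p∈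
  ... | c , c<q , p∈c with ∈-concatUpTo⁻ (λ e → block c (suc e) (+ 0) (- + e) q) (q ∸ c) p∈c
  ... | e , e<q-c , p∈ce with ∈block⁻ c (suc e) (+ 0) (- + e) q p∈ce
  ... | k , k∈ , refl = σ=0,e>0 c<q e<q-c k∈ , refl
  ∈family⁻ 3 _ p∈ with ∈-concatUpTo⁻ (λ c → concatUpTo (λ e → block c (suc e) -[1+ 0 ] (x - + e) e) q) q p∈
  ... | c , c<q , p∈c with ∈-concatUpTo⁻ (λ e → block c (suc e) -[1+ 0 ] (x - + e) e) q p∈c
  ... | e , e<q , p∈ce with ∈block⁻ c (suc e) -[1+ 0 ] (x - + e) e p∈ce
  ... | k , k∈ , refl = σ=-1 c<q e<q k∈ , refl
  ∈family⁻ (suc (suc (suc (suc _)))) (s≤s (s≤s (s≤s (s≤s ())))) _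

  params-sound : ∀ {p} → p ∈ params → Family p
  params-sound p∈ with ∈-concatUpTo⁻ family 4 p∈
  ... | t , t<4 , p∈t = proj₁ (∈family⁻ t t<4 p∈t)

  params-complete : ∀ {p} → Family p → p ∈ params
  params-complete (σ=1 k∈) =
    ∈-concatUpTo⁺ family {4} {0} (s≤s z≤n) (∈block⁺ 0 0 (+ 1) (- x) q k∈)
  params-complete (σ=0,e=0 {c} c<q k∈) =
    ∈-concatUpTo⁺ family {4} {1} (s≤s (s≤s z≤n))
      (∈-concatUpTo⁺ (λ c → block c 0 (+ 0) (+ 0) q) c<q (∈block⁺ c 0 (+ 0) (+ 0) q k∈))
  params-complete (σ=0,e>0 {c} {e} c<q e<q-c k∈) =
    ∈-concatUpTo⁺ family {4} {2} (s≤s (s≤s (s≤s z≤n)))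
      (∈-concatUpTo⁺ (λ c → concatUpTo (λ e → block c (suc e) (+ 0) (- + e) q) (q ∸ c)) c<q
        (∈-concatUpTo⁺ (λ e → block c (suc e) (+ 0) (- + e) q) e<q-c (∈block⁺ c (suc e) (+ 0) (- + e) q k∈)))
  params-complete (σ=-1 {c} {e} c<q e<q k∈) =
    ∈-concatUpTo⁺ family {4} {3} (s≤s (s≤s (s≤s (s≤s z≤n))))
      (∈-concatUpTo⁺ (λ c → concatUpTo (λ e → block c (suc e) -[1+ 0 ] (x - + e) e) q) c<q
        (∈-concatUpTo⁺ (λ e → block c (suc e) -[1+ 0 ] (x - + e) e) e<q (∈block⁺ c (suc e) -[1+ 0 ] (x - + e) e k∈)))

  -- Blocks are told apart by c, then by e, then by k.
  params-unique : Unique params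
  params-unique = concatUpTo-unique familyIndex family 4 (λ t _ → family-unique t)
                                    (λ t<4 p∈ → proj₂ (∈family⁻ _ t<4 p∈))
    where
      nested-unique : ∀ σ (a : ℕ → ℤ) (len m : ℕ → ℕ) →
        Unique (concatUpTo (λ c → concatUpTo (λ e → block c (suc e) σ (a e) (len e)) (m c)) q)
      nested-unique σ a len m =
        concatUpTo-unique Param.c _ q
          (λ c _ → concatUpTo-unique (λ p → ℕ.pred (Param.e p)) _ (m c)
                     (λ e _ → block-unique c (suc e) σ (a e) (len e))
                     (λ {e} _ p∈ → cong ℕ.pred (∈block⇒e c (suc e) σ (a e) (len e) p∈)))
          (λ {c} _ p∈ → let (e , _ , p∈ce) = ∈-concatUpTo⁻ (λ e → block c (suc e) σ (a e) (len e)) (m c) p∈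
                         in ∈block⇒c c (suc e) σ (a e) (len e) p∈ce)
      family-unique : ∀ t → Unique (family t)
      family-unique 0 = block-unique 0 0 (+ 1) (- x) q
      family-unique 1 = concatUpTo-unique Param.c _ q (λ c _ → block-unique c 0 (+ 0) (+ 0) q)
                                          (λ {c} _ → ∈block⇒c c 0 (+ 0) (+ 0) q)
      family-unique 2 = nested-unique (+ 0) (λ e → - + e) (λ _ → q) (λ c → q ∸ c)
      family-unique (suc (suc (suc _))) = nested-unique -[1+ 0 ] (λ e → x - + e) (λ e → e) (λ _ → q)

  -- |params| = q + q² + Σ_{c<q} (q - c)q + Σ_{c<q} Σ_{e<q} e = q + q² + q³.
  length-params : length params ≡ q ℕ.+ q ℕ.* q ℕ.+ q ℕ.* q ℕ.* q
  length-params = begin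
    length params
      ≡⟨ length-concatUpTo family 4 (λ t _ → refl) ⟩
    0 ℕ.+ length (family 0) ℕ.+ length (family 1) ℕ.+ length (family 2) ℕ.+ length (family 3)
      ≡⟨ cong₂ ℕ._+_ (cong₂ ℕ._+_ (cong₂ ℕ._+_ (cong (0 ℕ.+_) length₀) length₁) length₂) length₃ ⟩
    0 ℕ.+ q ℕ.+ q ℕ.* q ℕ.+ S ℕ.* q ℕ.+ q ℕ.* U
      ≡⟨ regroup q S U ⟩
    q ℕ.+ q ℕ.* q ℕ.+ (S ℕ.+ U) ℕ.* q
      ≡⟨ cong (λ t → q ℕ.+ q ℕ.* q ℕ.+ t ℕ.* q) S+U ⟩
    q ℕ.+ q ℕ.* q ℕ.+ q ℕ.* q ℕ.* q
      ∎
    where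
      open ≡-Reasoning
      S U : ℕ
      S = sumUpTo (λ c → q ∸ c) q
      U = sumUpTo (λ e → e) q
      length₀ : length (family 0) ≡ q
      length₀ = length-block 0 0 (+ 1) (- x) q
      length₁ : length (family 1) ≡ q ℕ.* q
      length₁ = trans (length-concatUpTo _ q (λ c _ → length-block c 0 (+ 0) (+ 0) q)) (sumUpTo-const q q)
      length₂ : length (family 2) ≡ S ℕ.* q
      length₂ = trans (length-concatUpTo _ q (λ c _ →
                        trans (length-concatUpTo _ (q ∸ c) (λ e _ → length-block c (suc e) (+ 0) (- + e) q))
                              (sumUpTo-const q (q ∸ c))))
                      (sumUpTo-*ʳ (λ c → q ∸ c) q q)
      length₃ : length (family 3) ≡ q ℕ.* U
      length₃ = trans (length-concatUpTo _ q (λ c _ →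
                        length-concatUpTo _ q (λ e _ → length-block c (suc e) -[1+ 0 ] (x - + e) e)))
                      (sumUpTo-const U q)
      S+U : S ℕ.+ U ≡ q ℕ.* q
      S+U = trans (sumUpTo-+ (λ c → q ∸ c) (λ e → e) q)
                  (trans (sumUpTo-cong q (λ c c<q → ℕP.m∸n+n≡m (ℕP.<⇒≤ c<q))) (sumUpTo-const q q))
      regroup : ∀ q S U → 0 ℕ.+ q ℕ.+ q ℕ.* q ℕ.+ S ℕ.* q ℕ.+ q ℕ.* U ≡ q ℕ.+ q ℕ.* q ℕ.+ (S ℕ.+ U) ℕ.* q
      regroup = ℕSolver.solve-∀

  count-identity : + (q ℕ.+ q ℕ.* q ℕ.+ q ℕ.* q ℕ.* q)
                   ≡ + 1 - (x * x * x - + 2 * x + + 1) + (x * x * x - x) + (x * x * x + x * x)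
  count-identity = begin
    + (q ℕ.+ q ℕ.* q ℕ.+ q ℕ.* q ℕ.* q)     ≡⟨ ℤP.pos-+ (q ℕ.+ q ℕ.* q) (q ℕ.* q ℕ.* q) ⟩
    + (q ℕ.+ q ℕ.* q) + + (q ℕ.* q ℕ.* q)   ≡⟨ cong₂ _+_ (ℤP.pos-+ q (q ℕ.* q)) (ℤP.pos-* (q ℕ.* q) q) ⟩
    x + + (q ℕ.* q) + + (q ℕ.* q) * x       ≡⟨ cong (λ s → x + s + s * x) (ℤP.pos-* q q) ⟩
    x + x * x + x * x * x                   ≡⟨ expand x ⟩
    + 1 - (x * x * x - + 2 * x + + 1) + (x * x * x - x) + (x * x * x + x * x) ∎
    where
      open ≡-Reasoning
      expand : ∀ X → X + X * X + X * X * X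
                     ≡ + 1 - (X * X * X - + 2 * X + + 1) + (X * X * X - X) + (X * X * X + X * X)
      expand = solve-∀

-- Now q = q' + 2, so that the n = q - 1 coordinates j_ν and k_μ exist.
module Counting (q' : ℕ) where

  q n : ℕ
  q = suc (suc q')
  n = suc q'

  open Parametrisation q (s≤s z≤n) public

  n≡x-1 : + n ≡ x - + 1
  n≡x-1 = shift (+ q')
    where
      shift : ∀ a → + 1 + a ≡ + 1 + (+ 1 + a) - + 1
      shift = solve-∀

  Σreplicate : ∀ y → sumℤ (replicate n y) ≡ (x - + 1) * y
  Σreplicate y = trans (sumℤ-replicate n y) (cong (_* y) n≡x-1)

  Ω⋆ : Point q → Set
  Ω⋆ = InΩ q (x * x * x - x) (replicate n (+ 0)) (replicate n (+ 0)) (x * x * x + x * x)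

  conditions⇒Ω⋆ : ∀ {i j k} → ΩConditions i j k → Ω⋆ (i , replicate n j , replicate n k)
  conditions⇒Ω⋆ {i} {j} {k} (conditions i-bound k-window j-window u-bound) =
    i-bound , AllPair-replicate n k-window ,
    AllPair-replicate n (subst (JWindow i j) (sym (Σreplicate k)) j-window) ,
    subst₂ (UBound i) (sym (Σreplicate j)) (sym (Σreplicate k)) u-bound

  Ω⋆⇒conditions : ∀ {i j k} → Ω⋆ (i , replicate n j , replicate n k) → ΩConditions i j k
  Ω⋆⇒conditions {i} {j} {k} (i-bound , (k-window , _) , (j-window , _) , u-bound) =
    conditions i-bound k-window
      (subst (JWindow i j) (Σreplicate k) j-window)
      (subst₂ (UBound i) (Σreplicate j) (Σreplicate k) u-bound)

  -- The k-window (resp. j-window) condition determines k (resp. j) uniquely, so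
  -- all k_μ (resp. all j_ν) of a point of Ω⋆ coincide.
  Ω⋆-constant : ∀ {i j k} → Ω⋆ (i , j , k) → j ≡ replicate n (Vec.head j) × k ≡ replicate n (Vec.head k)
  Ω⋆-constant {i} {j₀ ∷ js} {k₀ ∷ ks} (_ , (k-window , k-windows) , (j-window , j-windows) , _) =
    AllPair-functional (window-unique (λ y → x * i + Q * y - (x + + 1) * sumℤ (k₀ ∷ ks)) Q≥0
                                      (slope-j (x * i) ((x + + 1) * sumℤ (k₀ ∷ ks)) Q))
      j-window (j₀ ∷ js) (j-window , j-windows) ,
    AllPair-functional (window-unique (λ y → i + Q * y) Q≥0 (slope-k i Q))
      k-window (k₀ ∷ ks) (k-window , k-windows)
    where
      slope-k : ∀ i Q y z → (i + Q * y) - (i + Q * z) ≡ Q * (y - z)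
      slope-k = solve-∀
      slope-j : ∀ a S Q y z → (a + Q * y - S) - (a + Q * z - S) ≡ Q * (y - z)
      slope-j = solve-∀

  point : Param → Point q
  point p = I p , replicate n (J p) , replicate n (Param.k p)

  admissible⇒Ω⋆ : ∀ {p} → Admissible p → Ω⋆ (point p)
  admissible⇒Ω⋆ adm = conditions⇒Ω⋆ (admissible⇒conditions adm)

  point-paramOf : ∀ {i j k} → KWindow i k → point (paramOf i j k) ≡ (i , replicate n j , replicate n k)
  point-paramOf {i} {j} {k} k-window =
    cong₂ (λ i′ j′ → i′ , replicate n j′ , replicate n k) (paramOf-I {i} {j} {k} k-window) (paramOf-J i j k)

  Ω⋆⇒admissible : ∀ {y} → Ω⋆ y → Σ Param λ p → Admissible p × y ≡ point p
  Ω⋆⇒admissible {i , j , k} ω =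
    p , conditions⇒admissible (paramOf-c<q {i} {j₀} {k₀} k-window) (paramOf-e≤q i j₀ k₀)
                              (Ω⋆⇒conditions (subst Ω⋆ y≡point ω)) ,
    y≡point
    where
      j₀ k₀ : ℤ
      j₀ = Vec.head j
      k₀ = Vec.head k
      constant : (i , j , k) ≡ (i , replicate n j₀ , replicate n k₀)
      constant = cong₂ (λ j′ k′ → i , j′ , k′) (proj₁ (Ω⋆-constant ω)) (proj₂ (Ω⋆-constant ω))
      k-window : KWindow i k₀
      k-window = ΩConditions.k-window (Ω⋆⇒conditions (subst Ω⋆ constant ω))
      p : Param
      p = paramOf i j₀ k₀
      y≡point : (i , j , k) ≡ point p
      y≡point = trans constant (sym (point-paramOf k-window))

  -- Distinct parameters with e ≤ q give distinct points: the point determines k,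
  -- then the residue (q+1)c + e and so its digits c and e, and finally σ.
  point-injective : ∀ {p p'} → Param.e p ℕ.≤ q → Param.e p' ℕ.≤ q → point p ≡ point p' → p ≡ p'
  point-injective {param c e k σ} {param c' e' k' σ'} e≤q e'≤q same-point =
    same-parameters c≡c' e≡e' k≡k' (same-σ {c} {k} {σ} {σ'} J≡J')
    where
      k≡k' : k ≡ k'
      k≡k' = cong (λ y → Vec.head (proj₂ (proj₂ y))) same-point
      digits≡ : c ≡ c' × e ≡ e'
      digits≡ = divmod-unique q e≤q e'≤q
                  (same-residue {c} {e} {c'} {e'} {k} {k'} {σ} {σ'} (cong proj₁ same-point) k≡k')
      c≡c' = proj₁ digits≡
      e≡e' = proj₂ digits≡
      same-parameters : c ≡ c' → e ≡ e' → k ≡ k' → σ ≡ σ' → param c e k σ ≡ param c' e' k' σ'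
      same-parameters refl refl refl refl = refl
      J≡J' : J (param c 0 k σ) ≡ J (param c 0 k σ')
      J≡J' = trans (cong (λ y → Vec.head (proj₁ (proj₂ y))) same-point)
                   (cong₂ (λ c″ k″ → J (param c″ 0 k″ σ')) (sym c≡c') (sym k≡k'))

  Ω⋆-card : HasCard Ω⋆ (length params)
  Ω⋆-card = hasCard-image point params params-unique
    (λ p∈ p′∈ → point-injective (Admissible.e≤q (enumerated p∈)) (Admissible.e≤q (enumerated p′∈)))
    (λ p∈ → admissible⇒Ω⋆ (enumerated p∈))
    (λ ω → let (p , adm , y≡point) = Ω⋆⇒admissible ω in p , params-complete (admissible⇒family adm) , y≡point)
    where
      enumerated : ∀ {p} → p ∈ params → Admissible p
      enumerated p∈ = family⇒admissible (params-sound p∈)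

-- A prime power q = pᵏ with k ≥ 1 satisfies q ≥ 2ᵏ ≥ 2.
prime-power≥2 : ∀ {q} → IsPrimePower q → 2 ℕ.≤ q
prime-power≥2 (p , k , p-prime , 1≤k , refl) =
  ℕP.≤-trans (ℕP.^-monoʳ-≤ 2 1≤k) (ℕP.^-monoˡ-≤ k (ℕ.nonTrivial⇒n>1 p {{prime⇒nonTrivial p-prime}}))

lemma3p9 : (q : ℕ) → IsPrimePower q →
    Σ ℕ λ N →
    HasCard (InΩ q ((+ q) * (+ q) * (+ q) - (+ q))
    (replicate (q ∸ 1) (+ 0))
    (replicate (q ∸ 1) (+ 0))
    ((+ q) * (+ q) * (+ q) + (+ q) * (+ q))) N
    × (+ N ≡ + 1 - ((+ q) * (+ q) * (+ q) - (+ 2) * (+ q) + (+ 1))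
    + ((+ q) * (+ q) * (+ q) - (+ q))
    + ((+ q) * (+ q) * (+ q) + (+ q) * (+ q)))
lemma3p9 q q-prime-power with prime-power≥2 q-prime-power
lemma3p9 (suc (suc q')) _ | s≤s (s≤s _) =
  length params , Ω⋆-card , trans (cong +_ length-params) count-identity
  where
    open Counting q'
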